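{- Let $f=(\vec A,\vec b)$ with $\vec A\in\mathbb Z^{n\times n}$, $\vec b\in\mathbb Z^n$, $f(\vec v)=\vec A\vec v+\vec b$, and let $\alpha,\beta\ge0$ be integers such that $\vec A^\alpha=\vec A^{\alpha+\beta}$. Then for all $\vec v\in\mathbb Z^n$, $r\in[0,\beta-1]$ and $p\in\mathbb N$: $f^{\alpha+p\beta+r}(\vec v)=f^{\alpha+r}(\vec v)+p\cdot\vec A^\alpha\cdot f^\beta(\vec 0)$.
   Context: $f^j$ denotes the $j$-fold composition of $f$ with itself ($f^0$ the identity). -}

module Defs where

open import Data.Nat using (ℕ; zero; suc)
open import Data.Fin using (Fin)
open import Data.Integer using (ℤ; _+_; _*_; 0ℤ; 1ℤ)
open import Data.Fin using (_≟_)
open import Relation.Nullary using (yes; no)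

Vecℤ : ℕ → Set
Vecℤ n = Fin n → ℤ

Matℤ : ℕ → Set
Matℤ n = Fin n → Fin n → ℤ

∑ : ∀ {n} → (Fin n → ℤ) → ℤ
∑ {zero}  f = 0ℤ
∑ {suc n} f = f Fin.zero + ∑ (λ i → f (Fin.suc i))
  where import Data.Fin as Fin

𝟎 : ∀ {n} → Vecℤ n
𝟎 _ = 0ℤ

_⊕_ : ∀ {n} → Vecℤ n → Vecℤ n → Vecℤ n
(u ⊕ v) i = u i + v i

_·_ : ∀ {n} → ℤ → Vecℤ n → Vecℤ n
(c · v) i = c * v i

_⊛_ : ∀ {n} → Matℤ n → Vecℤ n → Vecℤ n
(A ⊛ v) i = ∑ (λ j → A i j * v j)

_⊗_ : ∀ {n} → Matℤ n → Matℤ n → Matℤ n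
(A ⊗ B) i k = ∑ (λ j → A i j * B j k)

I : ∀ {n} → Matℤ n
I i j with i ≟ j
... | yes _ = 1ℤ
... | no  _ = 0ℤ

_^ᴹ_ : ∀ {n} → Matℤ n → ℕ → Matℤ n
A ^ᴹ zero  = I
A ^ᴹ suc k = A ⊗ (A ^ᴹ k)

affine : ∀ {n} → Matℤ n → Vecℤ n → Vecℤ n → Vecℤ n
affine A b v = (A ⊛ v) ⊕ b

iter : ∀ {X : Set} → (X → X) → ℕ → X → X
iter f zero    x = x
iter f (suc j) x = f (iter f j x)

-- Write f^k(v) = f^k(0) + A^k v. Since A^(α+β) = A^α this gives
-- f^(α+β)(v) = f^α(v) + d with the drift d = A^α f^β(0). Expanding f^(β+1)(0)
-- as f(f^β 0) and as f^β(f 0) yields A f^β(0) + b = f^β(0) + A^β b; applying A^α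
-- and using A^(α+β) b = A^α b shows A d = d. So d is invariant under the linear
-- part, and each further block of β steps adds another copy of it.
module Submission where

open import Defs
open import Data.Nat using (ℕ; _<_; zero; suc) renaming (_+_ to _+ℕ_; _*_ to _*ℕ_)
import Data.Nat.Properties as ℕ
open import Data.Integer using (ℤ; +_; _+_; _*_; 0ℤ; 1ℤ)
import Data.Integer.Properties as ℤ
open import Data.Fin using (Fin; zero; suc; _≟_)
open import Data.Fin.Properties using (suc-injective)
open import Function using (_∘_)
open import Relation.Nullary using (yes; no; contradiction)
open import Relation.Binary.PropositionalEquality
  using (_≡_; _≢_; _≗_; refl; sym; trans; cong; cong₂; _→-setoid_; module ≡-Reasoning)
import Relation.Binary.Reasoning.Setoid as SetoidReasoning
import Algebra.Properties.CommutativeSemigroup ℤ.+-commutativeSemigroup as +-Comm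
import Algebra.Properties.CommutativeSemigroup ℤ.*-commutativeSemigroup as *-Comm
import Algebra.Properties.CommutativeSemigroup ℕ.+-commutativeSemigroup as ℕ-+
open import Algebra.Properties.AbelianGroup ℤ.+-0-abelianGroup using (∙-cancelʳ)

∑-cong : ∀ {n} {f g : Fin n → ℤ} → f ≗ g → ∑ f ≡ ∑ g
∑-cong {zero}  f≗g = refl
∑-cong {suc n} f≗g = cong₂ _+_ (f≗g zero) (∑-cong (f≗g ∘ suc))

∑-0 : ∀ n → ∑ {n} (λ _ → 0ℤ) ≡ 0ℤ
∑-0 zero    = refl
∑-0 (suc n) = trans (ℤ.+-identityˡ _) (∑-0 n)

∑-distrib-+ : ∀ {n} (f g : Fin n → ℤ) → ∑ (λ j → f j + g j) ≡ ∑ f + ∑ g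
∑-distrib-+ {zero}  f g = refl
∑-distrib-+ {suc n} f g = trans (cong (_+_ (f zero + g zero)) (∑-distrib-+ (f ∘ suc) (g ∘ suc)))
                                (+-Comm.interchange (f zero) (g zero) _ _)

*-distribˡ-∑ : ∀ {n} c (f : Fin n → ℤ) → c * ∑ f ≡ ∑ (λ j → c * f j)
*-distribˡ-∑ {zero}  c f = ℤ.*-zeroʳ c
*-distribˡ-∑ {suc n} c f = trans (ℤ.*-distribˡ-+ c (f zero) _)
                                 (cong (_+_ (c * f zero)) (*-distribˡ-∑ c (f ∘ suc)))

*-distribʳ-∑ : ∀ {n} c (f : Fin n → ℤ) → ∑ f * c ≡ ∑ (λ j → f j * c)
*-distribʳ-∑ c f = trans (ℤ.*-comm _ c)
                         (trans (*-distribˡ-∑ c f) (∑-cong (λ j → ℤ.*-comm c (f j))))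

∑-comm : ∀ {m n} (f : Fin m → Fin n → ℤ) → ∑ (λ i → ∑ (f i)) ≡ ∑ (λ j → ∑ (λ i → f i j))
∑-comm {zero}  {n} f = sym (∑-0 n)
∑-comm {suc m}     f = trans (cong (_+_ (∑ (f zero))) (∑-comm (f ∘ suc)))
                             (sym (∑-distrib-+ (f zero) _))

∑-single : ∀ {n} (f : Fin n → ℤ) i → (∀ j → j ≢ i → f j ≡ 0ℤ) → ∑ f ≡ f i
∑-single {suc n} f zero    off = trans (cong (_+_ (f zero)) ∑-tail≡0) (ℤ.+-identityʳ (f zero))
  where
  ∑-tail≡0 : ∑ (f ∘ suc) ≡ 0ℤ
  ∑-tail≡0 = trans (∑-cong (λ j → off (suc j) λ ())) (∑-0 n)
∑-single {suc n} f (suc i) off = trans (cong₂ _+_ (off zero λ ()) ∑-tail≡fᵢ) (ℤ.+-identityˡ _)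
  where
  ∑-tail≡fᵢ : ∑ (f ∘ suc) ≡ f (suc i)
  ∑-tail≡fᵢ = ∑-single (f ∘ suc) i (λ j j≢i → off (suc j) (j≢i ∘ suc-injective))

module _ {n : ℕ} where

  ⊕-cong : {u u′ v v′ : Vecℤ n} → u ≗ u′ → v ≗ v′ → u ⊕ v ≗ u′ ⊕ v′
  ⊕-cong u≗u′ v≗v′ i = cong₂ _+_ (u≗u′ i) (v≗v′ i)

  ⊕-congˡ : (u : Vecℤ n) {v v′ : Vecℤ n} → v ≗ v′ → u ⊕ v ≗ u ⊕ v′
  ⊕-congˡ u v≗v′ i = cong (_+_ (u i)) (v≗v′ i)

  ⊕-congʳ : {u u′ : Vecℤ n} (v : Vecℤ n) → u ≗ u′ → u ⊕ v ≗ u′ ⊕ v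
  ⊕-congʳ v u≗u′ i = cong (λ x → x + v i) (u≗u′ i)

  ⊕-identityˡ : (v : Vecℤ n) → 𝟎 ⊕ v ≗ v
  ⊕-identityˡ v i = ℤ.+-identityˡ (v i)

  ⊕-identityʳ : (v : Vecℤ n) → v ⊕ 𝟎 ≗ v
  ⊕-identityʳ v i = ℤ.+-identityʳ (v i)

  ⊕-assoc : (u v w : Vecℤ n) → (u ⊕ v) ⊕ w ≗ u ⊕ (v ⊕ w)
  ⊕-assoc u v w i = ℤ.+-assoc (u i) (v i) (w i)

  ⊕-xy∙z≈xz∙y : (u v w : Vecℤ n) → (u ⊕ v) ⊕ w ≗ (u ⊕ w) ⊕ v
  ⊕-xy∙z≈xz∙y u v w i = +-Comm.xy∙z≈xz∙y (u i) (v i) (w i)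

  ⊕-cancelʳ : (u v w : Vecℤ n) → u ⊕ w ≗ v ⊕ w → u ≗ v
  ⊕-cancelʳ u v w eq i = ∙-cancelʳ (w i) (u i) (v i) (eq i)

  ·-suc : ∀ p (v : Vecℤ n) → (+ suc p) · v ≗ v ⊕ ((+ p) · v)
  ·-suc p v i = trans (ℤ.*-distribʳ-+ (v i) 1ℤ (+ p))
                      (cong (λ x → x + + p * v i) (ℤ.*-identityˡ (v i)))

  ⊛-congˡ : {A B : Matℤ n} → (∀ i j → A i j ≡ B i j) → (v : Vecℤ n) → A ⊛ v ≗ B ⊛ v
  ⊛-congˡ A≡B v i = ∑-cong (λ j → cong (_* v j) (A≡B i j))

  ⊛-congʳ : (A : Matℤ n) {u v : Vecℤ n} → u ≗ v → A ⊛ u ≗ A ⊛ v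
  ⊛-congʳ A u≗v i = ∑-cong (λ j → cong (A i j *_) (u≗v j))

  ⊛-identityˡ : (v : Vecℤ n) → I ⊛ v ≗ v
  ⊛-identityˡ v i = trans (∑-single (λ j → I i j * v j) i off) diag
    where
    off : ∀ j → j ≢ i → I i j * v j ≡ 0ℤ
    off j j≢i with i ≟ j
    ... | yes i≡j = contradiction (sym i≡j) j≢i
    ... | no  _   = refl
    diag : I i i * v i ≡ v i
    diag with i ≟ i
    ... | yes _   = ℤ.*-identityˡ (v i)
    ... | no  i≢i = contradiction refl i≢i

  ⊛-assoc : (A B : Matℤ n) (v : Vecℤ n) → (A ⊗ B) ⊛ v ≗ A ⊛ (B ⊛ v)
  ⊛-assoc A B v i = begin
    ∑ (λ k → ∑ (λ j → A i j * B j k) * v k)    ≡⟨ ∑-cong (λ k → *-distribʳ-∑ (v k) (λ j → A i j * B j k)) ⟩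
    ∑ (λ k → ∑ (λ j → A i j * B j k * v k))    ≡⟨ ∑-comm (λ k j → A i j * B j k * v k) ⟩
    ∑ (λ j → ∑ (λ k → A i j * B j k * v k))    ≡⟨ ∑-cong (λ j → ∑-cong (λ k → ℤ.*-assoc (A i j) (B j k) (v k))) ⟩
    ∑ (λ j → ∑ (λ k → A i j * (B j k * v k)))  ≡⟨ ∑-cong (λ j → *-distribˡ-∑ (A i j) (λ k → B j k * v k)) ⟨
    ∑ (λ j → A i j * ∑ (λ k → B j k * v k))    ∎
    where open ≡-Reasoning

  ⊛-distribˡ-⊕ : (A : Matℤ n) (u v : Vecℤ n) → A ⊛ (u ⊕ v) ≗ (A ⊛ u) ⊕ (A ⊛ v)
  ⊛-distribˡ-⊕ A u v i = trans (∑-cong (λ j → ℤ.*-distribˡ-+ (A i j) (u j) (v j)))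
                               (∑-distrib-+ (λ j → A i j * u j) (λ j → A i j * v j))

  ⊛-· : (A : Matℤ n) (c : ℤ) (v : Vecℤ n) → A ⊛ (c · v) ≗ c · (A ⊛ v)
  ⊛-· A c v i = trans (∑-cong (λ j → *-Comm.x∙yz≈y∙xz (A i j) c (v j)))
                      (sym (*-distribˡ-∑ c (λ j → A i j * v j)))

  ⊛-zeroʳ : (A : Matℤ n) → A ⊛ 𝟎 ≗ 𝟎
  ⊛-zeroʳ A i = trans (∑-cong (λ j → ℤ.*-zeroʳ (A i j))) (∑-0 n)

module _ {n : ℕ} (A : Matℤ n) where

  open SetoidReasoning (Fin n →-setoid ℤ)

  ^ᴹ-+-⊛ : ∀ m k (v : Vecℤ n) → (A ^ᴹ (m +ℕ k)) ⊛ v ≗ (A ^ᴹ m) ⊛ ((A ^ᴹ k) ⊛ v)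
  ^ᴹ-+-⊛ zero    k v = begin
    (A ^ᴹ k) ⊛ v        ≈⟨ ⊛-identityˡ _ ⟨
    I ⊛ ((A ^ᴹ k) ⊛ v)  ∎
  ^ᴹ-+-⊛ (suc m) k v = begin
    (A ⊗ (A ^ᴹ (m +ℕ k))) ⊛ v         ≈⟨ ⊛-assoc A _ v ⟩
    A ⊛ ((A ^ᴹ (m +ℕ k)) ⊛ v)         ≈⟨ ⊛-congʳ A (^ᴹ-+-⊛ m k v) ⟩
    A ⊛ ((A ^ᴹ m) ⊛ ((A ^ᴹ k) ⊛ v))  ≈⟨ ⊛-assoc A _ _ ⟨
    (A ⊗ (A ^ᴹ m)) ⊛ ((A ^ᴹ k) ⊛ v)  ∎

  ^ᴹ-comm-⊛ : ∀ m (v : Vecℤ n) → (A ^ᴹ m) ⊛ (A ⊛ v) ≗ A ⊛ ((A ^ᴹ m) ⊛ v)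
  ^ᴹ-comm-⊛ zero    v = begin
    I ⊛ (A ⊛ v)  ≈⟨ ⊛-identityˡ _ ⟩
    A ⊛ v        ≈⟨ ⊛-congʳ A (⊛-identityˡ v) ⟨
    A ⊛ (I ⊛ v)  ∎
  ^ᴹ-comm-⊛ (suc m) v = begin
    (A ⊗ (A ^ᴹ m)) ⊛ (A ⊛ v)   ≈⟨ ⊛-assoc A _ _ ⟩
    A ⊛ ((A ^ᴹ m) ⊛ (A ⊛ v))   ≈⟨ ⊛-congʳ A (^ᴹ-comm-⊛ m v) ⟩
    A ⊛ (A ⊛ ((A ^ᴹ m) ⊛ v))   ≈⟨ ⊛-congʳ A (⊛-assoc A _ v) ⟨
    A ⊛ ((A ⊗ (A ^ᴹ m)) ⊛ v)   ∎

  ^ᴹ-fixed : ∀ {c : Vecℤ n} → A ⊛ c ≗ c → ∀ k → (A ^ᴹ k) ⊛ c ≗ c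
  ^ᴹ-fixed {c} fixed zero    = ⊛-identityˡ c
  ^ᴹ-fixed {c} fixed (suc k) = begin
    (A ⊗ (A ^ᴹ k)) ⊛ c  ≈⟨ ⊛-assoc A _ c ⟩
    A ⊛ ((A ^ᴹ k) ⊛ c)  ≈⟨ ⊛-congʳ A (^ᴹ-fixed fixed k) ⟩
    A ⊛ c               ≈⟨ fixed ⟩
    c                   ∎

  ·-fixed : ∀ {c : Vecℤ n} → A ⊛ c ≗ c → ∀ z → A ⊛ (z · c) ≗ z · c
  ·-fixed fixed z i = trans (⊛-· A z _ i) (cong (_*_ z) (fixed i))

iter-+ : ∀ {X : Set} (h : X → X) m k x → iter h (m +ℕ k) x ≡ iter h m (iter h k x)
iter-+ h zero    k x = refl
iter-+ h (suc m) k x = cong h (iter-+ h m k x)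

iter-sucʳ : ∀ {X : Set} (h : X → X) k x → iter h (suc k) x ≡ iter h k (h x)
iter-sucʳ h zero    x = refl
iter-sucʳ h (suc k) x = cong h (iter-sucʳ h k x)

iter-cong : ∀ {X Y : Set} {h : (X → Y) → (X → Y)} → (∀ {u v} → u ≗ v → h u ≗ h v) →
            ∀ k {u v} → u ≗ v → iter h k u ≗ iter h k v
iter-cong h-cong zero    u≗v = u≗v
iter-cong h-cong (suc k) u≗v = h-cong (iter-cong h-cong k u≗v)

module Affine {n : ℕ} (A : Matℤ n) (b : Vecℤ n) where

  open SetoidReasoning (Fin n →-setoid ℤ)

  f : Vecℤ n → Vecℤ n
  f = affine A b

  f-cong : ∀ {u v} → u ≗ v → f u ≗ f v
  f-cong u≗v = ⊕-congʳ b (⊛-congʳ A u≗v)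

  iter-⊕ : ∀ k w c → iter f k (w ⊕ c) ≗ iter f k w ⊕ ((A ^ᴹ k) ⊛ c)
  iter-⊕ zero    w c = begin
    w ⊕ c        ≈⟨ ⊕-congˡ w (⊛-identityˡ c) ⟨
    w ⊕ (I ⊛ c)  ∎
  iter-⊕ (suc k) w c = begin
    (A ⊛ iter f k (w ⊕ c)) ⊕ b                          ≈⟨ ⊕-congʳ b (⊛-congʳ A (iter-⊕ k w c)) ⟩
    (A ⊛ (iter f k w ⊕ ((A ^ᴹ k) ⊛ c))) ⊕ b             ≈⟨ ⊕-congʳ b (⊛-distribˡ-⊕ A (iter f k w) ((A ^ᴹ k) ⊛ c)) ⟩
    ((A ⊛ iter f k w) ⊕ (A ⊛ ((A ^ᴹ k) ⊛ c))) ⊕ b      ≈⟨ ⊕-xy∙z≈xz∙y (A ⊛ iter f k w) (A ⊛ ((A ^ᴹ k) ⊛ c)) b ⟩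
    ((A ⊛ iter f k w) ⊕ b) ⊕ (A ⊛ ((A ^ᴹ k) ⊛ c))      ≈⟨ ⊕-congˡ (f (iter f k w)) (⊛-assoc A (A ^ᴹ k) c) ⟨
    ((A ⊛ iter f k w) ⊕ b) ⊕ ((A ⊗ (A ^ᴹ k)) ⊛ c)      ∎

  iter-via-𝟎 : ∀ k v → iter f k v ≗ iter f k 𝟎 ⊕ ((A ^ᴹ k) ⊛ v)
  iter-via-𝟎 k v = begin
    iter f k v                      ≈⟨ iter-cong f-cong k (⊕-identityˡ v) ⟨
    iter f k (𝟎 ⊕ v)                ≈⟨ iter-⊕ k 𝟎 v ⟩
    iter f k 𝟎 ⊕ ((A ^ᴹ k) ⊛ v)     ∎

  iter-⊕-fixed : ∀ {c} → A ⊛ c ≗ c → ∀ k w → iter f k (w ⊕ c) ≗ iter f k w ⊕ c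
  iter-⊕-fixed {c} fixed k w = begin
    iter f k (w ⊕ c)                ≈⟨ iter-⊕ k w c ⟩
    iter f k w ⊕ ((A ^ᴹ k) ⊛ c)     ≈⟨ ⊕-congˡ (iter f k w) (^ᴹ-fixed A fixed k) ⟩
    iter f k w ⊕ c                  ∎

  iter-suc-𝟎 : ∀ k → (A ⊛ iter f k 𝟎) ⊕ b ≗ iter f k 𝟎 ⊕ ((A ^ᴹ k) ⊛ b)
  iter-suc-𝟎 k = begin
    iter f (suc k) 𝟎             ≡⟨ iter-sucʳ f k 𝟎 ⟩
    iter f k ((A ⊛ 𝟎) ⊕ b)       ≈⟨ iter-cong f-cong k (⊕-congʳ b (⊛-zeroʳ A)) ⟩
    iter f k (𝟎 ⊕ b)             ≈⟨ iter-⊕ k 𝟎 b ⟩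
    iter f k 𝟎 ⊕ ((A ^ᴹ k) ⊛ b)  ∎

module EventuallyPeriodic {n : ℕ} (A : Matℤ n) (b : Vecℤ n) (α β : ℕ)
    (A^α≡A^α+β : ∀ i j → (A ^ᴹ α) i j ≡ (A ^ᴹ (α +ℕ β)) i j) where

  open Affine A b
  open SetoidReasoning (Fin n →-setoid ℤ)

  drift : Vecℤ n
  drift = (A ^ᴹ α) ⊛ iter f β 𝟎

  ^ᴹ-α+β-⊛ : ∀ v → (A ^ᴹ (α +ℕ β)) ⊛ v ≗ (A ^ᴹ α) ⊛ v
  ^ᴹ-α+β-⊛ = ⊛-congˡ (λ i j → sym (A^α≡A^α+β i j))

  drift-fixed : A ⊛ drift ≗ drift
  drift-fixed = ⊕-cancelʳ (A ⊛ drift) drift (A^α ⊛ b) (begin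
    (A ⊛ drift) ⊕ (A^α ⊛ b)                   ≈⟨ ⊕-congʳ (A^α ⊛ b) (^ᴹ-comm-⊛ A α g) ⟨
    (A^α ⊛ (A ⊛ g)) ⊕ (A^α ⊛ b)               ≈⟨ ⊛-distribˡ-⊕ A^α (A ⊛ g) b ⟨
    A^α ⊛ ((A ⊛ g) ⊕ b)                       ≈⟨ ⊛-congʳ A^α (iter-suc-𝟎 β) ⟩
    A^α ⊛ (g ⊕ ((A ^ᴹ β) ⊛ b))                ≈⟨ ⊛-distribˡ-⊕ A^α g ((A ^ᴹ β) ⊛ b) ⟩
    drift ⊕ (A^α ⊛ ((A ^ᴹ β) ⊛ b))            ≈⟨ ⊕-congˡ drift (^ᴹ-+-⊛ A α β b) ⟨
    drift ⊕ ((A ^ᴹ (α +ℕ β)) ⊛ b)             ≈⟨ ⊕-congˡ drift (^ᴹ-α+β-⊛ b) ⟩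
    drift ⊕ (A^α ⊛ b)                         ∎)
    where
    A^α = A ^ᴹ α
    g   = iter f β 𝟎

  iter-α+β : ∀ v → iter f (α +ℕ β) v ≗ iter f α v ⊕ drift
  iter-α+β v = begin
    iter f (α +ℕ β) v                                   ≈⟨ iter-via-𝟎 (α +ℕ β) v ⟩
    iter f (α +ℕ β) 𝟎 ⊕ ((A ^ᴹ (α +ℕ β)) ⊛ v)          ≡⟨ cong (_⊕ ((A ^ᴹ (α +ℕ β)) ⊛ v)) (iter-+ f α β 𝟎) ⟩
    iter f α (iter f β 𝟎) ⊕ ((A ^ᴹ (α +ℕ β)) ⊛ v)      ≈⟨ ⊕-cong (iter-via-𝟎 α (iter f β 𝟎)) (^ᴹ-α+β-⊛ v) ⟩
    (iter f α 𝟎 ⊕ drift) ⊕ ((A ^ᴹ α) ⊛ v)              ≈⟨ ⊕-xy∙z≈xz∙y (iter f α 𝟎) drift ((A ^ᴹ α) ⊛ v) ⟩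
    (iter f α 𝟎 ⊕ ((A ^ᴹ α) ⊛ v)) ⊕ drift              ≈⟨ ⊕-congʳ drift (iter-via-𝟎 α v) ⟨
    iter f α v ⊕ drift                                  ∎

  iter-⊕-drift : ∀ k p w → iter f k (w ⊕ ((+ p) · drift)) ≗ iter f k w ⊕ ((+ p) · drift)
  iter-⊕-drift k p = iter-⊕-fixed (·-fixed A drift-fixed (+ p)) k

  iter-α+p*β : ∀ p v → iter f (α +ℕ p *ℕ β) v ≗ iter f α v ⊕ ((+ p) · drift)
  -- (+ 0) · drift reduces to 𝟎 pointwise.
  iter-α+p*β zero    v = begin
    iter f (α +ℕ 0) v                ≡⟨ cong (λ k → iter f k v) (ℕ.+-identityʳ α) ⟩
    iter f α v                       ≈⟨ ⊕-identityʳ (iter f α v) ⟨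
    iter f α v ⊕ ((+ 0) · drift)     ∎
  iter-α+p*β (suc p) v = begin
    iter f (α +ℕ (β +ℕ p *ℕ β)) v                        ≡⟨ cong (λ k → iter f k v) (ℕ-+.x∙yz≈y∙xz α β (p *ℕ β)) ⟩
    iter f (β +ℕ (α +ℕ p *ℕ β)) v                        ≡⟨ iter-+ f β (α +ℕ p *ℕ β) v ⟩
    iter f β (iter f (α +ℕ p *ℕ β) v)                    ≈⟨ iter-cong f-cong β (iter-α+p*β p v) ⟩
    iter f β (iter f α v ⊕ ((+ p) · drift))              ≈⟨ iter-⊕-drift β p (iter f α v) ⟩
    iter f β (iter f α v) ⊕ ((+ p) · drift)              ≡⟨ cong (_⊕ ((+ p) · drift)) (iter-+ f β α v) ⟨
    iter f (β +ℕ α) v ⊕ ((+ p) · drift)                  ≡⟨ cong (λ k → iter f k v ⊕ ((+ p) · drift)) (ℕ.+-comm β α) ⟩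
    iter f (α +ℕ β) v ⊕ ((+ p) · drift)                  ≈⟨ ⊕-congʳ ((+ p) · drift) (iter-α+β v) ⟩
    (iter f α v ⊕ drift) ⊕ ((+ p) · drift)               ≈⟨ ⊕-assoc (iter f α v) drift ((+ p) · drift) ⟩
    iter f α v ⊕ (drift ⊕ ((+ p) · drift))               ≈⟨ ⊕-congˡ (iter f α v) (·-suc p drift) ⟨
    iter f α v ⊕ ((+ suc p) · drift)                     ∎

lemma10 : (n : ℕ) (A : Matℤ n) (b : Vecℤ n) (α β : ℕ) →
          (∀ i j → (A ^ᴹ α) i j ≡ (A ^ᴹ (α +ℕ β)) i j) →
          (v : Vecℤ n) (r : ℕ) → r < β → (p : ℕ) →
          ∀ i → iter (affine A b) (α +ℕ p *ℕ β +ℕ r) v i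
                ≡ (iter (affine A b) (α +ℕ r) v
                   ⊕ ((+ p) · ((A ^ᴹ α) ⊛ iter (affine A b) β 𝟎))) i
lemma10 n A b α β A^α≡A^α+β v r _ p = begin
  iter f (α +ℕ p *ℕ β +ℕ r) v                   ≡⟨ cong (λ k → iter f k v) (ℕ.+-comm (α +ℕ p *ℕ β) r) ⟩
  iter f (r +ℕ (α +ℕ p *ℕ β)) v                 ≡⟨ iter-+ f r (α +ℕ p *ℕ β) v ⟩
  iter f r (iter f (α +ℕ p *ℕ β) v)             ≈⟨ iter-cong f-cong r (iter-α+p*β p v) ⟩
  iter f r (iter f α v ⊕ ((+ p) · drift))       ≈⟨ iter-⊕-drift r p (iter f α v) ⟩
  iter f r (iter f α v) ⊕ ((+ p) · drift)       ≡⟨ cong (_⊕ ((+ p) · drift)) (iter-+ f r α v) ⟨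
  iter f (r +ℕ α) v ⊕ ((+ p) · drift)           ≡⟨ cong (λ k → iter f k v ⊕ ((+ p) · drift)) (ℕ.+-comm r α) ⟩
  iter f (α +ℕ r) v ⊕ ((+ p) · drift)           ∎
  where
  open Affine A b
  open EventuallyPeriodic A b α β A^α≡A^α+β
  open SetoidReasoning (Fin n →-setoid ℤ)
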